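{- Let $\tau=\tau_1\tau_2\cdots\tau_\ell$ ($\ell\ge1$) be a generalized pattern without internal dashes consisting of the letters $1$ and $2$. Let $k=\lceil\log_2 \ell\rceil$, $a=m_\ell(\tau,D_k1C_k)$ and $b=m_\ell(\tau,D_k2C_k)$. Then for all $n>k+1$, $$c_n^{\tau}=\bigl(a+b+c_{k+1}^{\tau}+d_{k+1}^{\tau}\bigr)\cdot 2^{n-k-2}-b,\qquad d_n^{\tau}=\bigl(a+b+c_{k+1}^{\tau}+d_{k+1}^{\tau}\bigr)\cdot 2^{n-k-2}-a.$$
   Context: The sigma-words are the words over $\{1,2\}$ defined by $C_1=1$, $D_1=2$, $C_{k+1}=C_k1D_k$, $D_{k+1}=C_k2D_k$ for $k\ge1$; by convention $C_0$ and $D_0$ are the empty word (so $C_1=C_01D_0$, $D_1=C_02D_0$). The reduced form of a word $u$ over positive integers is obtained by replacing each letter by its rank among the distinct letters of $u$. A generalized pattern without internal dashes $\tau$ of length $\ell$ occurs in a word $w=w_1\cdots w_N$ at position $i$ if the factor (block of consecutive letters) $w_iw_{i+1}\cdots w_{i+\ell-1}$ has reduced form equal to $\tau$; the number of occurrences is the number of such positions $i$. $c_n^\tau$ and $d_n^\tau$ denote the number of occurrences of $\tau$ in $C_n$ and $D_n$. Kernel: if $W=AxB$ with $x$ a letter and $|A|=|B|$, the kernel of order $k$ of $W$, $\mathcal K_k(W)$, is the word formed by the $k-1$ rightmost letters of $A$, the letter $x$, and the $k-1$ leftmost letters of $B$ (it is the empty word if $|A|<k-1$). $m_k(\tau,W)$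 denotes the number of occurrences of $\tau$ in $\mathcal K_k(W)$. -}

module Defs where

open import Data.Nat using (ℕ; zero; suc; _+_; _∸_; _<?_; _<_; _≤_)
open import Data.Nat.Properties using (_≟_)
open import Data.Nat.Logarithm public using (⌈log₂_⌉)
open import Data.List using (List; []; _∷_; _++_; length; filter; take; drop; deduplicate; upTo; [_])
open import Data.List.Properties using (≡-dec)
open import Data.Nat.DivMod using (_/_)
open import Relation.Nullary using (yes; no)

Word : Set
Word = List ℕ

C D : ℕ → Word
C zero    = []
C (suc k) = C k ++ 1 ∷ D k
D zero    = []
D (suc k) = C k ++ 2 ∷ D k

rank : Word → ℕ → ℕ
rank u x = suc (length (deduplicate _≟_ (filter (_<? x) u)))

red : Word → Word
red u = Data.List.map (rank u) u

-- number of occurrences of the pattern τ (without internal dashes) in w: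
-- positions i (0-based) with i + |τ| ≤ |w| whose factor of length |τ| reduces to τ
occ : Word → Word → ℕ
occ τ w = length (filter (λ i → ≡-dec _≟_ (red (take (length τ) (drop i w))) τ)
                         (upTo (suc (length w) ∸ length τ)))

-- kernel of order k of W = A x B with |A| = |B| (W of odd length, x the middle letter)
kernel : ℕ → Word → Word
kernel k W with length W / 2
... | m with drop m W
...   | []      = []
...   | x ∷ B with length (take m W) <? k ∸ 1
...     | yes _ = []
...     | no  _ = drop (m ∸ (k ∸ 1)) (take m W) ++ x ∷ take (k ∸ 1) B

mk : ℕ → Word → Word → ℕ
mk k τ W = occ τ (kernel k W)

data Letter12 : ℕ → Set where
  one : Letter12 1
  two : Letter12 2

{-# OPTIONS --safe #-}
module Submission where

-- An occurrence of a pattern τ of length ℓ is a factor of length ℓ, so in a word A x B with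
-- |A| = |B| ≥ ℓ - 1 it lies inside A, inside B, or inside the kernel of order ℓ:
-- occ τ (A x B) = occ τ A + m_ℓ(τ, A x B) + occ τ B.  Since |C_k| = |D_k| = 2^k - 1 ≥ ℓ - 1 and,
-- for n > k, C_n ends with D_k while D_n begins with C_k, the kernels of C_n 1 D_n and C_n 2 D_n
-- are those of D_k 1 C_k and D_k 2 C_k.  Hence c_{n+1} = c_n + a + d_n and d_{n+1} = c_n + b + d_n
-- for n > k, so c_n + b = d_n + a for n > k + 1, and this common value doubles at every step.

open import Defs
open import Data.Bool using (true; false; if_then_else_)
open import Data.Empty using (⊥-elim)
open import Data.Integer using (+_; _-_; _⊖_)
open import Data.Integer.Properties using ([+m]-[+n]≡m⊖n; ⊖-≥)
open import Data.List using (List; []; _∷_; [_]; _++_; length; filter; take; drop; applyUpTo)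
open import Data.List.Properties using (≡-dec; length-++; length-++-≤ˡ; length-map; length-take; length-drop; take++drop≡id; take-all; drop-drop; ++-assoc)
open import Data.List.Relation.Unary.All using (All)
open import Data.Nat using (ℕ; zero; suc; _+_; _*_; _∸_; _^_; _≤_; _<_; _≥_; _≤′_; ≤′-refl; ≤′-step; z≤n; s≤s; s≤s⁻¹; _≤?_; ⌈_/2⌉)
open import Data.Nat.Divisibility using (n∣m*n)
open import Data.Nat.DivMod using (_/_; +-distrib-/-∣ʳ; m*n/n≡m)
open import Data.Nat.Induction using (<-wellFounded)
open import Data.Nat.Logarithm.Core using (⌈log2⌉)
open import Data.Nat.Properties
open import Data.Nat.Solver using (module +-*-Solver)
open import Data.Product using (_×_; _,_; ∃)
open import Function using (_∘_; id)
open import Induction.WellFounded using (Acc; acc)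
open import Relation.Nullary using (yes; no; does)
open import Relation.Unary using (Pred; Decidable)
open import Relation.Binary.PropositionalEquality using (_≡_; refl; sym; trans; cong; cong₂; subst; module ≡-Reasoning)
open +-*-Solver using (solve; _:+_; _:*_; _:=_; con)
open ≡-Reasoning

variable
  X : Set
  x y m n : ℕ
  u v w : Word

takeLast : ℕ → List X → List X
takeLast m u = drop (length u ∸ m) u

drop-length-++ : (u v : List X) → drop (length u) (u ++ v) ≡ v
drop-length-++ []      v = refl
drop-length-++ (_ ∷ u) v = drop-length-++ u v

take-++ˡ : ∀ m (u v : List X) → m ≤ length u → take m (u ++ v) ≡ take m u
take-++ˡ zero    u       v _         = refl
take-++ˡ (suc m) (x ∷ u) v (s≤s m≤u) = cong (x ∷_) (take-++ˡ m u v m≤u)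

take-length-++ : (u v : List X) → take (length u) (u ++ v) ≡ u
take-length-++ u v = trans (take-++ˡ (length u) u v ≤-refl) (take-all (length u) u ≤-refl)

take-++-take : ∀ m n (u v : List X) → m ≤ n → take m (u ++ v) ≡ take m (u ++ take n v)
take-++-take zero    n       u       v       _         = refl
take-++-take (suc m) (suc n) []      []      _         = refl
take-++-take (suc m) (suc n) []      (y ∷ v) (s≤s m≤n) = cong (y ∷_) (take-++-take m n [] v m≤n)
take-++-take (suc m) n       (x ∷ u) v       m<n       = cong (x ∷_) (take-++-take m n u v (<⇒≤ m<n))

length-takeLast : ∀ m (u : List X) → m ≤ length u → length (takeLast m u) ≡ m
length-takeLast m u m≤u = trans (length-drop (length u ∸ m) u) (m∸[m∸n]≡n m≤u)

takeLast-++ : ∀ m (u v : List X) → m ≤ length v → takeLast m (u ++ v) ≡ takeLast m v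
takeLast-++ m u v m≤v = begin
  drop (length (u ++ v) ∸ m) (u ++ v)             ≡⟨ cong (λ l → drop (l ∸ m) (u ++ v)) (length-++ u) ⟩
  drop (length u + length v ∸ m) (u ++ v)         ≡⟨ cong (λ l → drop l (u ++ v)) (+-∸-assoc (length u) m≤v) ⟩
  drop (length u + (length v ∸ m)) (u ++ v)       ≡⟨ drop-drop (length u) (length v ∸ m) (u ++ v) ⟨
  drop (length v ∸ m) (drop (length u) (u ++ v))  ≡⟨ cong (drop (length v ∸ m)) (drop-length-++ u v) ⟩
  drop (length v ∸ m) v                           ∎

[n+1+n]/2≡n : ∀ n → (n + suc n) / 2 ≡ n
[n+1+n]/2≡n n = begin
  (n + suc n) / 2  ≡⟨ cong (_/ 2) (solve 1 (λ n → n :+ (con 1 :+ n) := con 1 :+ n :* con 2) refl n) ⟩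
  (1 + n * 2) / 2  ≡⟨ +-distrib-/-∣ʳ 1 {d = 2} (n∣m*n n) ⟩
  n * 2 / 2        ≡⟨ m*n/n≡m n 2 ⟩
  n                ∎

kernel-centre : ∀ m (A B : Word) x → length B ≡ length A → m ≤ length A →
                kernel (suc m) (A ++ x ∷ B) ≡ takeLast m A ++ x ∷ take m B
kernel-centre m A B x |B|≡|A| m≤A
  rewrite length-++ A {x ∷ B} | |B|≡|A| | [n+1+n]/2≡n (length A) | drop-length-++ A (x ∷ B)
  with length (take (length A) (A ++ x ∷ B)) <? m
... | yes A<m = ⊥-elim (<⇒≱ A<m (subst (m ≤_) (sym (cong length (take-length-++ A (x ∷ B)))) m≤A))
... | no  _   = cong (λ a → drop (length A ∸ m) a ++ x ∷ take m B) (take-length-++ A (x ∷ B))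

length-C≡length-D : ∀ n → length (C n) ≡ length (D n)
length-C≡length-D zero    = refl
length-C≡length-D (suc n) = trans (length-++ (C n)) (sym (length-++ (C n)))

1+length-C≡2^ : ∀ n → suc (length (C n)) ≡ 2 ^ n
1+length-C≡2^ zero    = refl
1+length-C≡2^ (suc n) = begin
  suc (length (C n ++ 1 ∷ D n))                 ≡⟨ cong suc (length-++ (C n)) ⟩
  suc (length (C n) + suc (length (D n)))       ≡⟨ cong (λ d → suc (length (C n) + suc d)) (length-C≡length-D n) ⟨
  suc (length (C n)) + suc (length (C n))       ≡⟨ cong₂ _+_ (1+length-C≡2^ n) (trans (1+length-C≡2^ n) (sym (+-identityʳ (2 ^ n)))) ⟩
  2 ^ n + (2 ^ n + 0)                           ∎

C-prefix : ∀ {k} → k ≤′ n → ∃ λ Q → C n ++ y ∷ D n ≡ C k ++ Q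
C-prefix {y = y} {k} ≤′-refl = y ∷ D k , refl
C-prefix {suc n} {y} {k} (≤′-step k≤n) with Q , C≡CQ ← C-prefix {y = 1} k≤n =
  Q ++ y ∷ D (suc n) , trans (cong (_++ y ∷ D (suc n)) C≡CQ) (++-assoc (C k) Q (y ∷ D (suc n)))

D-suffix : ∀ {k} → k ≤′ n → ∃ λ P → C n ++ y ∷ D n ≡ P ++ D k
D-suffix {y = y} {k} ≤′-refl = C k ++ [ y ] , sym (++-assoc (C k) [ y ] (D k))
D-suffix {suc n} {y} {k} (≤′-step k≤n) with P , D≡PD ← D-suffix {y = 2} k≤n =
  C (suc n) ++ y ∷ P , trans (cong (λ d → C (suc n) ++ y ∷ d) D≡PD) (sym (++-assoc (C (suc n)) (y ∷ P) (D k)))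

length-C-≤ : ∀ {k} → k ≤′ n → length (C k) ≤ length (C n ++ y ∷ D n)
length-C-≤ {k = k} k≤n with Q , C≡CQ ← C-prefix k≤n = subst (length (C k) ≤_) (cong length (sym C≡CQ)) (length-++-≤ˡ (C k))

kernel-C-D : ∀ {k} m x → k ≤′ n → m ≤ length (C k) →
             kernel (suc m) (C (suc n) ++ x ∷ D (suc n)) ≡ kernel (suc m) (D k ++ x ∷ C k)
kernel-C-D {n} {k} m x k≤n m≤Ck
  with P , C≡PD ← D-suffix {y = 1} k≤n | Q , D≡CQ ← C-prefix {y = 2} k≤n = begin
  kernel (suc m) (C (suc n) ++ x ∷ D (suc n))       ≡⟨ kernel-centre m (C (suc n)) (D (suc n)) x (sym (length-C≡length-D (suc n))) m≤Csn ⟩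
  takeLast m (C (suc n)) ++ x ∷ take m (D (suc n))  ≡⟨ cong₂ (λ c d → takeLast m c ++ x ∷ take m d) C≡PD D≡CQ ⟩
  takeLast m (P ++ D k) ++ x ∷ take m (C k ++ Q)    ≡⟨ cong₂ (λ c d → c ++ x ∷ d) (takeLast-++ m P (D k) m≤Dk) (take-++ˡ m (C k) Q m≤Ck) ⟩
  takeLast m (D k) ++ x ∷ take m (C k)              ≡⟨ kernel-centre m (D k) (C k) x (length-C≡length-D k) m≤Dk ⟨
  kernel (suc m) (D k ++ x ∷ C k)                   ∎
  where
    m≤Dk : m ≤ length (D k)
    m≤Dk = subst (m ≤_) (length-C≡length-D k) m≤Ck
    m≤Csn : m ≤ length (C (suc n))
    m≤Csn = ≤-trans m≤Ck (length-C-≤ k≤n)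

length-filter-∷ : ∀ {p} {P : Pred X p} (P? : Decidable P) y ys →
                  length (filter P? (y ∷ ys)) ≡ (if does (P? y) then 1 else 0) + length (filter P? ys)
length-filter-∷ P? y ys with does (P? y)
... | true  = refl
... | false = refl

length-filter-applyUpTo-suc : ∀ {p} {P : Pred ℕ p} (P? : Decidable P) (f : ℕ → ℕ) r →
  length (filter P? (applyUpTo (suc ∘ f) r)) ≡ length (filter (P? ∘ suc) (applyUpTo f r))
length-filter-applyUpTo-suc P? f zero = refl
length-filter-applyUpTo-suc P? f (suc r) with does (P? (suc (f 0)))
... | true  = cong suc (length-filter-applyUpTo-suc P? (f ∘ suc) r)
... | false = length-filter-applyUpTo-suc P? (f ∘ suc) r

occursAt? : (τ w : Word) → Decidable (λ i → red (take (length τ) (drop i w)) ≡ τ)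
occursAt? τ w i = ≡-dec _≟_ (red (take (length τ) (drop i w))) τ

χ : Word → Word → ℕ
χ τ u = if does (≡-dec _≟_ (red u) τ) then 1 else 0

χ-length : ∀ τ u → length u < length τ → χ τ u ≡ 0
χ-length τ u u<τ with ≡-dec _≟_ (red u) τ
... | no  _      = refl
... | yes red≡τ  = ⊥-elim (<-irrefl (trans (sym (length-map (rank u) u)) (cong length red≡τ)) u<τ)

occ-short : ∀ τ w → length w < length τ → occ τ w ≡ 0
occ-short τ w w<τ rewrite m≤n⇒m∸n≡0 w<τ = refl

module _ {t : ℕ} {σ : Word} where
  private
    τ : Word
    τ = t ∷ σ
    ℓ₀ : ℕ
    ℓ₀ = length σ

  occ-∷ : occ τ (x ∷ w) ≡ χ τ (take (suc ℓ₀) (x ∷ w)) + occ τ w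
  occ-∷ {x} {w} with ℓ₀ ≤? length w
  ... | yes ℓ₀≤w rewrite +-∸-assoc 1 ℓ₀≤w =
    trans (length-filter-∷ (occursAt? τ (x ∷ w)) 0 (applyUpTo suc (length w ∸ ℓ₀)))
          (cong (_+_ (χ τ (take (suc ℓ₀) (x ∷ w))))
                (length-filter-applyUpTo-suc (occursAt? τ (x ∷ w)) id (length w ∸ ℓ₀)))
  ... | no  ℓ₀≰w = begin
    occ τ (x ∷ w)                          ≡⟨ occ-short τ (x ∷ w) (s≤s w<ℓ₀) ⟩
    0 + 0                                  ≡⟨ cong₂ _+_ (χ-length τ (x ∷ w) (s≤s w<ℓ₀)) (occ-short τ w (m<n⇒m<1+n w<ℓ₀)) ⟨
    χ τ (x ∷ w) + occ τ w                  ≡⟨ cong (λ u → χ τ u + occ τ w) (take-all (suc ℓ₀) (x ∷ w) (s≤s (<⇒≤ w<ℓ₀))) ⟨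
    χ τ (take (suc ℓ₀) (x ∷ w)) + occ τ w  ∎
    where
      w<ℓ₀ = ≰⇒> ℓ₀≰w

  occ-++ : ∀ (u v : Word) → occ τ (u ++ v) ≡ occ τ (u ++ take ℓ₀ v) + occ τ v
  occ-++ [] v = cong (λ c → c + occ τ v) (sym (occ-short τ (take ℓ₀ v) short))
    where
      short : length (take ℓ₀ v) < suc ℓ₀
      short = s≤s (≤-trans (≤-reflexive (length-take ℓ₀ v)) (m⊓n≤m _ _))
  occ-++ (x ∷ u) v = begin
    occ τ (x ∷ u ++ v)                                  ≡⟨ occ-∷ ⟩
    χ τ (x ∷ take ℓ₀ (u ++ v)) + occ τ (u ++ v)         ≡⟨ cong₂ _+_ (cong (χ τ ∘ (x ∷_)) (take-++-take ℓ₀ ℓ₀ u v ≤-refl)) (occ-++ u v) ⟩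
    h + (occ τ (u ++ take ℓ₀ v) + occ τ v)              ≡⟨ +-assoc h _ _ ⟨
    h + occ τ (u ++ take ℓ₀ v) + occ τ v                ≡⟨ cong (λ c → c + occ τ v) occ-∷ ⟨
    occ τ (x ∷ u ++ take ℓ₀ v) + occ τ v                ∎
    where
      h = χ τ (x ∷ take ℓ₀ (u ++ take ℓ₀ v))

  occ-++-window : ∀ (u S w : Word) → length S ≡ ℓ₀ →
                  occ τ (u ++ S ++ w) ≡ occ τ (u ++ S) + occ τ (S ++ w)
  occ-++-window u S w |S|≡ℓ₀ =
    trans (occ-++ u (S ++ w)) (cong (λ s → occ τ (u ++ s) + occ τ (S ++ w)) takeS)
    where
      takeS : take ℓ₀ (S ++ w) ≡ S
      takeS = trans (take-++ˡ ℓ₀ S w (≤-reflexive (sym |S|≡ℓ₀))) (take-all ℓ₀ S (≤-reflexive |S|≡ℓ₀))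

  occ-++-∷ : ∀ (A B : Word) x → ℓ₀ ≤ length A →
             occ τ (A ++ x ∷ B) ≡ occ τ A + occ τ (takeLast ℓ₀ A ++ x ∷ take ℓ₀ B) + occ τ B
  occ-++-∷ A B x ℓ₀≤A = begin
    occ τ (A ++ x ∷ B)                                         ≡⟨ cong (λ a → occ τ (a ++ x ∷ B)) (take++drop≡id r A) ⟨
    occ τ ((P ++ S) ++ x ∷ B)                                  ≡⟨ cong (occ τ) (++-assoc P S (x ∷ B)) ⟩
    occ τ (P ++ S ++ x ∷ B)                                    ≡⟨ occ-++-window P S (x ∷ B) (length-takeLast ℓ₀ A ℓ₀≤A) ⟩
    occ τ (P ++ S) + occ τ (S ++ x ∷ B)                        ≡⟨ cong₂ (λ a s → occ τ a + occ τ s) (take++drop≡id r A) (sym (++-assoc S [ x ] B)) ⟩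
    occ τ A + occ τ ((S ++ [ x ]) ++ B)                        ≡⟨ cong (_+_ (occ τ A)) (occ-++ (S ++ [ x ]) B) ⟩
    occ τ A + (occ τ ((S ++ [ x ]) ++ take ℓ₀ B) + occ τ B)    ≡⟨ cong (λ s → occ τ A + (occ τ s + occ τ B)) (++-assoc S [ x ] (take ℓ₀ B)) ⟩
    occ τ A + (occ τ (S ++ x ∷ take ℓ₀ B) + occ τ B)           ≡⟨ +-assoc (occ τ A) _ _ ⟨
    occ τ A + occ τ (S ++ x ∷ take ℓ₀ B) + occ τ B             ∎
    where
      r = length A ∸ ℓ₀
      P = take r A
      S = takeLast ℓ₀ A

  occ-kernel : ∀ (A B : Word) x → length B ≡ length A → ℓ₀ ≤ length A →
               occ τ (A ++ x ∷ B) ≡ occ τ A + mk (length τ) τ (A ++ x ∷ B) + occ τ B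
  occ-kernel A B x |B|≡|A| ℓ₀≤A =
    trans (occ-++-∷ A B x ℓ₀≤A) (cong (λ K → occ τ A + occ τ K + occ τ B) (sym (kernel-centre ℓ₀ A B x |B|≡|A| ℓ₀≤A)))

  occ-C-D-step : ∀ {k} x → k ≤′ n → ℓ₀ ≤ length (C k) →
                 occ τ (C (suc n) ++ x ∷ D (suc n)) ≡ occ τ (C (suc n)) + mk (length τ) τ (D k ++ x ∷ C k) + occ τ (D (suc n))
  occ-C-D-step {n} {k} x k≤n ℓ₀≤Ck = begin
    occ τ (C (suc n) ++ x ∷ D (suc n))
      ≡⟨ occ-kernel (C (suc n)) (D (suc n)) x |D|≡|C| ℓ₀≤Csn ⟩
    occ τ (C (suc n)) + mk (length τ) τ (C (suc n) ++ x ∷ D (suc n)) + occ τ (D (suc n))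
      ≡⟨ cong (λ K → occ τ (C (suc n)) + occ τ K + occ τ (D (suc n))) (kernel-C-D ℓ₀ x k≤n ℓ₀≤Ck) ⟩
    occ τ (C (suc n)) + mk (length τ) τ (D k ++ x ∷ C k) + occ τ (D (suc n))
      ∎
    where
      |D|≡|C| = sym (length-C≡length-D (suc n))
      ℓ₀≤Csn = ≤-trans ℓ₀≤Ck (length-C-≤ k≤n)

module _ (c d : ℕ → ℕ) (a b : ℕ)
         (c-step : ∀ i → c (suc i) ≡ c i + a + d i)
         (d-step : ∀ i → d (suc i) ≡ c i + b + d i) where

  c+b≡d+a : ∀ i → c (suc i) + b ≡ d (suc i) + a
  c+b≡d+a i = begin
    c (suc i) + b      ≡⟨ cong (λ e → e + b) (c-step i) ⟩
    c i + a + d i + b  ≡⟨ solve 4 (λ c a d b → c :+ a :+ d :+ b := c :+ b :+ d :+ a) refl (c i) a (d i) b ⟩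
    c i + b + d i + a  ≡⟨ cong (λ e → e + a) (d-step i) ⟨
    d (suc i) + a      ∎

  c+b-doubles : ∀ i → c (suc (suc i)) + b ≡ 2 * (c (suc i) + b)
  c+b-doubles i = begin
    c (suc (suc i)) + b                   ≡⟨ cong (λ e → e + b) (c-step (suc i)) ⟩
    c (suc i) + a + d (suc i) + b         ≡⟨ solve 4 (λ c a d b → c :+ a :+ d :+ b := (c :+ b) :+ (d :+ a)) refl (c (suc i)) a (d (suc i)) b ⟩
    (c (suc i) + b) + (d (suc i) + a)     ≡⟨ cong (_+_ (c (suc i) + b)) (c+b≡d+a i) ⟨
    (c (suc i) + b) + (c (suc i) + b)     ≡⟨ solve 1 (λ e → e :+ e := con 2 :* e) refl (c (suc i) + b) ⟩
    2 * (c (suc i) + b)                   ∎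

  c+b≡S*2^ : ∀ j → c (suc j) + b ≡ (a + b + c 0 + d 0) * 2 ^ j
  c+b≡S*2^ zero = begin
    c 1 + b                        ≡⟨ cong (λ e → e + b) (c-step 0) ⟩
    c 0 + a + d 0 + b              ≡⟨ solve 4 (λ c a d b → c :+ a :+ d :+ b := (a :+ b :+ c :+ d) :* con 1) refl (c 0) a (d 0) b ⟩
    (a + b + c 0 + d 0) * 1        ∎
  c+b≡S*2^ (suc j) = begin
    c (suc (suc j)) + b            ≡⟨ c+b-doubles j ⟩
    2 * (c (suc j) + b)            ≡⟨ cong (2 *_) (c+b≡S*2^ j) ⟩
    2 * (S * 2 ^ j)                ≡⟨ solve 2 (λ S p → con 2 :* (S :* p) := S :* (con 2 :* p)) refl S (2 ^ j) ⟩
    S * (2 * 2 ^ j)                ∎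
    where S = a + b + c 0 + d 0

  d+a≡S*2^ : ∀ j → d (suc j) + a ≡ (a + b + c 0 + d 0) * 2 ^ j
  d+a≡S*2^ j = trans (sym (c+b≡d+a j)) (c+b≡S*2^ j)

n≤2^⌈log2⌉n : ∀ n (rec : Acc _<_ n) → n ≤ 2 ^ ⌈log2⌉ n rec
n≤2^⌈log2⌉n zero          _        = z≤n
n≤2^⌈log2⌉n (suc zero)    _        = s≤s z≤n
n≤2^⌈log2⌉n (suc (suc m)) (acc rs) =
  ≤-trans 2+m≤2*[1+⌈m/2⌉] (*-monoʳ-≤ 2 (n≤2^⌈log2⌉n (suc ⌈ m /2⌉) (rs (⌈n/2⌉<n m))))
  where
    m≤⌈m/2⌉+⌈m/2⌉ : m ≤ ⌈ m /2⌉ + ⌈ m /2⌉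
    m≤⌈m/2⌉+⌈m/2⌉ = subst (_≤ ⌈ m /2⌉ + ⌈ m /2⌉) (⌊n/2⌋+⌈n/2⌉≡n m) (+-monoˡ-≤ ⌈ m /2⌉ (⌊n/2⌋≤⌈n/2⌉ m))
    2+m≤2*[1+⌈m/2⌉] : suc (suc m) ≤ 2 * suc ⌈ m /2⌉
    2+m≤2*[1+⌈m/2⌉] = subst (suc (suc m) ≤_) (solve 1 (λ h → con 2 :+ (h :+ h) := con 2 :* (con 1 :+ h)) refl ⌈ m /2⌉)
                             (s≤s (s≤s m≤⌈m/2⌉+⌈m/2⌉))

m+n≡o⇒+m≡+o-+n : ∀ {o} → m + n ≡ o → + m ≡ + o - + n
m+n≡o⇒+m≡+o-+n {m} {n} refl = sym (begin
  + (m + n) - + n  ≡⟨ [+m]-[+n]≡m⊖n (m + n) n ⟩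
  (m + n) ⊖ n      ≡⟨ ⊖-≥ (m≤n+m n m) ⟩
  + (m + n ∸ n)    ≡⟨ cong +_ (m+n∸n≡m m n) ⟩
  + m              ∎)

2+[n∸k∸2]+k≡n : ∀ k {n} → suc k < n → suc (suc (n ∸ k ∸ 2 + k)) ≡ n
2+[n∸k∸2]+k≡n zero    {suc (suc n)} (s≤s (s≤s _)) = cong (suc ∘ suc) (+-identityʳ n)
2+[n∸k∸2]+k≡n (suc k) {suc n}       (s≤s k+1<n)   =
  trans (cong (suc ∘ suc) (+-suc (n ∸ k ∸ 2) k)) (cong suc (2+[n∸k∸2]+k≡n k k+1<n))

theorem4 : (τ : List ℕ) → All Letter12 τ → length τ ≥ 1 →
    let ℓ = length τ
        k = ⌈log₂ ℓ ⌉
        a = mk ℓ τ (D k ++ (1 ∷ C k))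
        b = mk ℓ τ (D k ++ (2 ∷ C k))
        S = a + b + occ τ (C (suc k)) + occ τ (D (suc k))
    in (n : ℕ) → suc k < n →
       (+ occ τ (C n) ≡ + (S * 2 ^ (n ∸ k ∸ 2)) - + b)
       × (+ occ τ (D n) ≡ + (S * 2 ^ (n ∸ k ∸ 2)) - + a)
theorem4 [] _ ()
theorem4 (t ∷ σ) _ _ n k+1<n =
    m+n≡o⇒+m≡+o-+n (subst (λ i → occ τ (C i) + b ≡ S * 2 ^ j) 2+j+k≡n (c+b≡S*2^ c d a b (step 1) (step 2) j))
  , m+n≡o⇒+m≡+o-+n (subst (λ i → occ τ (D i) + a ≡ S * 2 ^ j) 2+j+k≡n (d+a≡S*2^ c d a b (step 1) (step 2) j))
  where
    τ = t ∷ σ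
    k = ⌈log₂ length τ ⌉
    a = mk (length τ) τ (D k ++ 1 ∷ C k)
    b = mk (length τ) τ (D k ++ 2 ∷ C k)
    c d : ℕ → ℕ
    c i = occ τ (C (suc (i + k)))
    d i = occ τ (D (suc (i + k)))
    S = a + b + c 0 + d 0
    j = n ∸ k ∸ 2
    2+j+k≡n : suc (suc (j + k)) ≡ n
    2+j+k≡n = 2+[n∸k∸2]+k≡n k k+1<n
    σ≤Ck : length σ ≤ length (C k)
    σ≤Ck = s≤s⁻¹ (subst (length τ ≤_) (sym (1+length-C≡2^ k)) (n≤2^⌈log2⌉n (length τ) (<-wellFounded (length τ))))
    step : ∀ x i → occ τ (C (suc (i + k)) ++ x ∷ D (suc (i + k))) ≡ c i + mk (length τ) τ (D k ++ x ∷ C k) + d i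
    step x i = occ-C-D-step {t} {σ} x (n≤′m+n i k) σ≤Ck
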